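{- Let $M$ be a matroid on ground set $E$ with set of bases $\mathcal{B}$, and let $\mathcal{C}$ be a set of cuts of $M$ such that $\mathcal{B}_{\mathcal{C}}:=\{B\in\mathcal{B}:|B\cap C|\le1\text{ for all }C\in\mathcal{C}\}\ne\emptyset$. Then $\mathcal{B}_{\mathcal{C}}$ is the set of bases of a matroid on $E$.
   Context: A cut of a matroid is a minimal subset of the ground set that does not intersect any circuit in exactly one element; equivalently, a circuit of the dual matroid (a cocircuit). -}

module Defs where

open import Data.Nat using (ℕ; _≤_)
open import Data.Fin using (Fin)
open import Data.Fin.Subset using (Subset; _∈_; _∉_; _⊆_; _⊂_; _∩_; _∪_; _-_; ⁅_⁆; ∣_∣; Nonempty)
open import Data.Product using (_×_; ∃; ∃-syntax)
open import Relation.Nullary using (¬_)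
open import Relation.Binary.PropositionalEquality using (_≡_)

record IsMatroidBases (n : ℕ) (𝓑 : Subset n → Set) : Set where
  field
    basis-nonempty : ∃[ B ] 𝓑 B
    basis-exchange : ∀ B₁ B₂ → 𝓑 B₁ → 𝓑 B₂ → ∀ x → x ∈ B₁ → x ∉ B₂ →
                     ∃[ y ] (y ∈ B₂ × y ∉ B₁ × 𝓑 ((B₁ - x) ∪ ⁅ y ⁆))

record Matroid (n : ℕ) : Set₁ where
  field
    IsBasis  : Subset n → Set
    isMatroid : IsMatroidBases n IsBasis

module _ {n : ℕ} (M : Matroid n) where
  open Matroid M

  Independent : Subset n → Set
  Independent X = ∃[ B ] (IsBasis B × X ⊆ B)

  IsCircuit : Subset n → Set
  IsCircuit C = ¬ Independent C × (∀ D → D ⊂ C → Independent D)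

  MeetsNoCircuitInOne : Subset n → Set
  MeetsNoCircuitInOne X = ∀ C → IsCircuit C → ¬ (∣ X ∩ C ∣ ≡ 1)

  IsCut : Subset n → Set
  IsCut X = Nonempty X × MeetsNoCircuitInOne X ×
            (∀ Y → Y ⊂ X → Nonempty Y → ¬ MeetsNoCircuitInOne Y)

  RestrictedBases : (Subset n → Set) → Subset n → Set
  RestrictedBases 𝒞 B = IsBasis B × (∀ C → 𝒞 C → ∣ B ∩ C ∣ ≤ 1)

-- Take bases B₁, B₂ of 𝓑_𝒞 and x ∈ B₁ ∖ B₂. By symmetric exchange in M there is
-- y ∈ B₂ ∖ B₁ such that both B₁ - x + y and B₂ - y + x are bases of M. The
-- first one still meets every C ∈ 𝒞 at most once unless x ∉ C and y ∈ C; but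
-- then B₂ ∩ C = {y}, so the basis B₂ - y + x would miss the cut C, whereas
-- every basis meets every cut: otherwise adding an element c ∈ C to the basis
-- creates a circuit meeting C exactly in c.
module Submission where

open import Data.Nat using (ℕ; suc; _≤_; s≤s; z≤n)
open import Data.Nat.Properties using (≤-trans)
open import Data.Fin using (Fin; _≟_)
open import Data.Fin.Subset
  using (Subset; inside; outside; _∈_; _∉_; _⊆_; _⊂_; _∩_; _∪_; _─_; _-_; ⁅_⁆; ∣_∣; Nonempty)
open import Data.Fin.Subset.Properties
open import Data.Fin.Subset.Induction using (⊂-wellFounded)
open import Data.Fin.Properties using (any?)
open import Data.Vec using ([]; _∷_; here; there)
open import Data.Product using (_×_; _,_; proj₁; ∃-syntax)
open import Data.Sum using (_⊎_; inj₁; inj₂)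
open import Data.Empty using (⊥-elim)
open import Function using (_∘_)
open import Induction.WellFounded using (Acc; acc)
open import Relation.Nullary using (¬_; Dec; yes; no; ¬?; contradiction)
open import Relation.Nullary.Decidable using (_×-dec_; ¬¬-excluded-middle; decidable-stable)
open import Relation.Nullary.Negation using (¬¬-map)
open import Relation.Binary.PropositionalEquality using (_≡_; _≢_; refl; sym; subst; cong; trans; module ≡-Reasoning)

open import Defs

private
  variable
    n : ℕ
    p q B B₁ B₂ X : Subset n
    a b c d v x y y₀ y₁ z : Fin n

x∈p─q⇒x∉q : x ∈ p ─ q → x ∉ q
x∈p─q⇒x∉q {p = _ ∷ _} {q = outside ∷ _} here      = λ ()
x∈p─q⇒x∉q {p = _ ∷ _} {q = _ ∷ _}       (there m) = x∈p─q⇒x∉q m ∘ drop-there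

x∈p-y⇒x≢y : x ∈ p - y → x ≢ y
x∈p-y⇒x≢y {x = x} x∈p-y refl = x∈p─q⇒x∉q x∈p-y (x∈⁅x⁆ x)

∣p∣≤1⇒x≡y : ∣ p ∣ ≤ 1 → x ∈ p → y ∈ p → x ≡ y
∣p∣≤1⇒x≡y {p = p} {x = x} {y} ∣p∣≤1 x∈p y∈p with x ≟ y
... | yes x≡y = x≡y
... | no x≢y  = contradiction (≤-trans 2≤∣p∣ ∣p∣≤1) λ { (s≤s ()) }
  where
  1≤∣p-x∣ : 1 ≤ ∣ p - x ∣
  1≤∣p-x∣ = ≤-trans (s≤s z≤n) (x∈p⇒∣p-x∣<∣p∣ (x∈p∧x≢y⇒x∈p-y y∈p (x≢y ∘ sym)))
  2≤∣p∣ : 2 ≤ ∣ p ∣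
  2≤∣p∣ = ≤-trans (s≤s 1≤∣p-x∣) (x∈p⇒∣p-x∣<∣p∣ x∈p)

Subset-¬¬-shift : ∀ {ℓ} (P : Subset n → Set ℓ) → (∀ S → ¬ ¬ P S) → ¬ ¬ (∀ S → P S)
Subset-¬¬-shift {n = 0}     P ¬¬P ¬∀P = ¬¬P [] λ P[] → ¬∀P λ { [] → P[] }
Subset-¬¬-shift {n = suc n} P ¬¬P ¬∀P =
  Subset-¬¬-shift (P ∘ (inside ∷_))  (¬¬P ∘ (inside ∷_))  λ Pin →
  Subset-¬¬-shift (P ∘ (outside ∷_)) (¬¬P ∘ (outside ∷_)) λ Pout →
  ¬∀P λ { (inside ∷ S) → Pin S ; (outside ∷ S) → Pout S }

exchange : Subset n → Fin n → Fin n → Subset n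
exchange B x y = (B - x) ∪ ⁅ y ⁆

y∈exchange : ∀ (B : Subset n) x y → y ∈ exchange B x y
y∈exchange B x y = x∈p∪q⁺ (inj₂ (x∈⁅x⁆ y))

z∈exchange : z ∈ B → z ≢ x → z ∈ exchange B x y
z∈exchange z∈B z≢x = x∈p∪q⁺ (inj₁ (x∈p∧x≢y⇒x∈p-y z∈B z≢x))

∈-exchange⁻ : ∀ (B : Subset n) x y → z ∈ exchange B x y → (z ∈ B × z ≢ x) ⊎ z ≡ y
∈-exchange⁻ B x y z∈ with x∈p∪q⁻ (B - x) ⁅ y ⁆ z∈
... | inj₁ z∈B-x = inj₁ (p─q⊆p B ⁅ x ⁆ z∈B-x , x∈p-y⇒x≢y z∈B-x)
... | inj₂ z∈⁅y⁆ = inj₂ (x∈⁅y⁆⇒x≡y y z∈⁅y⁆)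

z∉exchange : z ∉ B → z ≢ y → z ∉ exchange B x y
z∉exchange z∉B z≢y z∈ with ∈-exchange⁻ _ _ _ z∈
... | inj₁ (z∈B , _) = z∉B z∈B
... | inj₂ z≡y       = z≢y z≡y

exchange-comm : ∀ (B : Subset n) → b ≢ c → d ≢ a →
                exchange (exchange B a b) c d ≡ exchange (exchange B c d) a b
exchange-comm B b≢c d≢a = ⊆-antisym (⊆-swapped B b≢c d≢a) (⊆-swapped B d≢a b≢c)
  where
  ⊆-swapped : ∀ (B : Subset n) → b ≢ c → d ≢ a →
              exchange (exchange B a b) c d ⊆ exchange (exchange B c d) a b
  ⊆-swapped {b = b} {c} {d} {a} B b≢c d≢a z∈ with ∈-exchange⁻ _ c d z∈
  ... | inj₂ refl = z∈exchange (y∈exchange B c d) d≢a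
  ... | inj₁ (z∈ , z≢c) with ∈-exchange⁻ B a b z∈
  ...   | inj₂ refl       = y∈exchange _ a b
  ...   | inj₁ (z∈B , z≢a) = z∈exchange (z∈exchange z∈B z≢c) z≢a

exchange-via : ∀ (B : Subset n) → v ∉ B → exchange (exchange B a v) v c ≡ exchange B a c
exchange-via {v = v} {a} {c} B v∉B = ⊆-antisym forward backward
  where
  forward : exchange (exchange B a v) v c ⊆ exchange B a c
  forward z∈ with ∈-exchange⁻ _ v c z∈
  ... | inj₂ refl = y∈exchange B a c
  ... | inj₁ (z∈ , z≢v) with ∈-exchange⁻ B a v z∈
  ...   | inj₂ z≡v         = contradiction z≡v z≢v
  ...   | inj₁ (z∈B , z≢a) = z∈exchange z∈B z≢a
  backward : exchange B a c ⊆ exchange (exchange B a v) v c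
  backward z∈ with ∈-exchange⁻ B a c z∈
  ... | inj₂ refl       = y∈exchange _ v c
  ... | inj₁ (z∈B , z≢a) = z∈exchange (z∈exchange z∈B z≢a) λ { refl → v∉B z∈B }

exchange-self : a ∈ B → exchange B a a ≡ B
exchange-self {a = a} {B = B} a∈B = ⊆-antisym forward backward
  where
  forward : exchange B a a ⊆ B
  forward z∈ with ∈-exchange⁻ B a a z∈
  ... | inj₂ refl     = a∈B
  ... | inj₁ (z∈B , _) = z∈B
  backward : B ⊆ exchange B a a
  backward {z} z∈B with z ≟ a
  ... | yes refl = y∈exchange B a a
  ... | no z≢a   = z∈exchange z∈B z≢a

exchange-restore : a ∈ B → c ≢ a → x ≢ c → exchange (exchange B a x) c a ≡ exchange B c x
exchange-restore {a = a} {B = B} {c} {x} a∈B c≢a x≢c = ⊆-antisym forward backward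
  where
  forward : exchange (exchange B a x) c a ⊆ exchange B c x
  forward z∈ with ∈-exchange⁻ _ c a z∈
  ... | inj₂ refl = z∈exchange a∈B (c≢a ∘ sym)
  ... | inj₁ (z∈ , z≢c) with ∈-exchange⁻ B a x z∈
  ...   | inj₂ refl     = y∈exchange B c x
  ...   | inj₁ (z∈B , _) = z∈exchange z∈B z≢c
  backward : exchange B c x ⊆ exchange (exchange B a x) c a
  backward {z} z∈ with ∈-exchange⁻ B c x z∈ | z ≟ a
  ... | inj₂ refl        | _        = z∈exchange (y∈exchange B a x) x≢c
  ... | inj₁ _           | yes refl = y∈exchange _ c a
  ... | inj₁ (z∈B , z≢c) | no z≢a   = z∈exchange (z∈exchange z∈B z≢a) z≢c

exchange-detour : ∀ (B : Subset n) → v ∉ B → x ≢ v → v ≢ y₁ → x ≢ y₀ → ∀ w →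
                  exchange (exchange (exchange B y₀ v) y₁ x) v w ≡ exchange (exchange B y₁ x) y₀ w
exchange-detour {v = v} {x} {y₁} {y₀} B v∉B x≢v v≢y₁ x≢y₀ w = begin
  exchange (exchange (exchange B y₀ v) y₁ x) v w ≡⟨ cong (λ E → exchange E v w) (exchange-comm B v≢y₁ x≢y₀) ⟩
  exchange (exchange (exchange B y₁ x) y₀ v) v w ≡⟨ exchange-via _ (z∉exchange v∉B (x≢v ∘ sym)) ⟩
  exchange (exchange B y₁ x) y₀ w                ∎
  where open ≡-Reasoning

─-exchange-⊂ : v ∈ p → v ∉ q → y ∉ p → p ─ exchange q y v ⊂ p ─ q
─-exchange-⊂ {v = v} {p} {q} {y} v∈p v∉q y∉p = ⊆-─ , v , x∈p∧x∉q⇒x∈p─q v∈p v∉q , v∉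
  where
  ⊆-─ : p ─ exchange q y v ⊆ p ─ q
  ⊆-─ z∈ = x∈p∧x∉q⇒x∈p─q (p─q⊆p p _ z∈)
           λ z∈q → x∈p─q⇒x∉q z∈ (z∈exchange z∈q λ { refl → y∉p (p─q⊆p p _ z∈) })
  v∉ : v ∉ p ─ exchange q y v
  v∉ v∈ = x∈p─q⇒x∉q v∈ (y∈exchange q y v)

module _ (M : Matroid n) where
  open Matroid M
  open IsMatroidBases isMatroid

  basis⊆basis⇒⊇ : IsBasis p → IsBasis q → p ⊆ q → q ⊆ p
  basis⊆basis⇒⊇ {p = p} {q} bp bq p⊆q {x} x∈q with x ∈? p
  ... | yes x∈p = x∈p
  ... | no x∉p with basis-exchange q p bq bp x x∈q x∉p
  ...   | y , y∈p , y∉q , _ = contradiction (p⊆q y∈p) y∉q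

  ⊆-Independent : p ⊆ q → Independent M q → Independent M p
  ⊆-Independent p⊆q (B , b , q⊆B) = B , b , q⊆B ∘ p⊆q

  basis∪⁅x⁆-dependent : IsBasis B → x ∉ B → ¬ Independent M (B ∪ ⁅ x ⁆)
  basis∪⁅x⁆-dependent {B = B} {x} b x∉B (B′ , b′ , B∪x⊆B′) =
    x∉B (basis⊆basis⇒⊇ b b′ (B∪x⊆B′ ∘ p⊆p∪q ⁅ x ⁆) (B∪x⊆B′ (q⊆p∪q B ⁅ x ⁆ (x∈⁅x⁆ x))))

  module Decidable (independent? : ∀ S → Dec (Independent M S)) where

    dependent⇒⊇circuit : ∀ S → ¬ Independent M S → ∃[ D ] (D ⊆ S × IsCircuit M D)
    dependent⇒⊇circuit S = go S (⊂-wellFounded S)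
      where
      go : ∀ S → Acc _⊂_ S → ¬ Independent M S → ∃[ D ] (D ⊆ S × IsCircuit M D)
      go S (acc smaller) dep with any? (λ s → s ∈? S ×-dec ¬? (independent? (S - s)))
      ... | yes (s , s∈S , dep′) with go (S - s) (smaller (x∈p⇒p-x⊂p s∈S)) dep′
      ...   | D , D⊆ , circuit = D , p─q⊆p S ⁅ s ⁆ ∘ D⊆ , circuit
      go S _ dep | no ¬removable = S , (λ z∈S → z∈S) , dep , proper⇒independent
        where
        proper⇒independent : ∀ D → D ⊂ S → Independent M D
        proper⇒independent D (D⊆S , s , s∈S , s∉D) with independent? (S - s)
        ... | yes ind = ⊆-Independent (λ z∈D → x∈p∧x≢y⇒x∈p-y (D⊆S z∈D) λ { refl → s∉D z∈D }) ind
        ... | no dep′ = contradiction (s , s∈S , dep′) ¬removable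

    fundamental-circuit : IsBasis B → x ∉ B → ∃[ D ] (IsCircuit M D × x ∈ D × D ⊆ B ∪ ⁅ x ⁆)
    fundamental-circuit {B = B} {x} b x∉B
      with dependent⇒⊇circuit (B ∪ ⁅ x ⁆) (basis∪⁅x⁆-dependent b x∉B)
    ... | D , D⊆ , circuit with x ∈? D
    ...   | yes x∈D = D , circuit , x∈D , D⊆
    ...   | no x∉D  = ⊥-elim (proj₁ circuit (B , b , D⊆B))
      where
      D⊆B : D ⊆ B
      D⊆B {z} z∈D with x∈p∪q⁻ B ⁅ x ⁆ (D⊆ z∈D)
      ... | inj₁ z∈B = z∈B
      ... | inj₂ z∈⁅x⁆ = contradiction (subst (_∈ D) (x∈⁅y⁆⇒x≡y x z∈⁅x⁆) z∈D) x∉D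

    basis-meets : MeetsNoCircuitInOne M X → Nonempty X → IsBasis B → Nonempty (B ∩ X)
    basis-meets {X = X} {B = B} meets-no-circuit-once (x , x∈X) b with nonempty? (B ∩ X)
    ... | yes meets = meets
    ... | no misses with fundamental-circuit b x∉B
      where
      x∉B : x ∉ B
      x∉B x∈B = misses (x , x∈p∩q⁺ (x∈B , x∈X))
    ...   | D , circuit , x∈D , D⊆B∪x =
      contradiction (trans (cong ∣_∣ X∩D≡⁅x⁆) (∣⁅x⁆∣≡1 x)) (meets-no-circuit-once D circuit)
      where
      X∩D⊆⁅x⁆ : X ∩ D ⊆ ⁅ x ⁆
      X∩D⊆⁅x⁆ {z} z∈ with x∈p∩q⁻ X D z∈
      ... | z∈X , z∈D with x∈p∪q⁻ B ⁅ x ⁆ (D⊆B∪x z∈D)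
      ...   | inj₁ z∈B   = contradiction (z , x∈p∩q⁺ (z∈B , z∈X)) misses
      ...   | inj₂ z∈⁅x⁆ = z∈⁅x⁆
      X∩D≡⁅x⁆ : X ∩ D ≡ ⁅ x ⁆
      X∩D≡⁅x⁆ = ⊆-antisym X∩D⊆⁅x⁆ λ z∈⁅x⁆ →
        subst (_∈ X ∩ D) (sym (x∈⁅y⁆⇒x≡y x z∈⁅x⁆)) (x∈p∩q⁺ (x∈X , x∈D))

  -- Independence is not decidable for an abstract basis predicate, but its
  -- decidability on the finitely many subsets is not refutable, which suffices
  -- for the decidable conclusion.
  basis-meets : MeetsNoCircuitInOne M X → Nonempty X → IsBasis B → Nonempty (B ∩ X)
  basis-meets meets-no-circuit-once nonempty b = decidable-stable (nonempty? _)
    (¬¬-map (λ independent? → Decidable.basis-meets independent? meets-no-circuit-once nonempty b)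
            (Subset-¬¬-shift (Dec ∘ Independent M) (λ _ → ¬¬-excluded-middle)))

  SymmetricExchange : Subset n → Subset n → Fin n → Set
  SymmetricExchange B₁ B₂ x =
    ∃[ y ] (y ∈ B₂ × y ∉ B₁ × IsBasis (exchange B₁ x y) × IsBasis (exchange B₂ y x))

  detour-basis : IsBasis B₂ → y₀ ∈ B₂ → y₁ ∈ B₂ → y₀ ≢ y₁ → v ∉ B₂ → x ≢ v → v ≢ y₁ → x ≢ y₀ →
                 IsBasis (exchange (exchange B₂ y₀ v) y₁ x) →
                 IsBasis (exchange B₂ y₁ x) ⊎ IsBasis (exchange B₂ y₀ x)
  detour-basis {B₂ = B₂} {y₀} {y₁} {v} b₂ y₀∈B₂ y₁∈B₂ y₀≢y₁ v∉B₂ x≢v v≢y₁ x≢y₀ bD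
    with basis-exchange _ B₂ bD b₂ v (z∈exchange (y∈exchange B₂ y₀ v) v≢y₁) v∉B₂
  ... | w , w∈B₂ , w∉D , bD′ with w ≟ y₀ | w ≟ y₁
  ...   | yes refl | _ = inj₁ (subst IsBasis
      (trans (exchange-detour B₂ v∉B₂ x≢v v≢y₁ x≢y₀ w) (exchange-self (z∈exchange y₀∈B₂ y₀≢y₁))) bD′)
  ...   | no _ | yes refl = inj₂ (subst IsBasis
      (trans (exchange-detour B₂ v∉B₂ x≢v v≢y₁ x≢y₀ w) (exchange-restore y₁∈B₂ y₀≢y₁ x≢y₀)) bD′)
  ...   | no w≢y₀ | no w≢y₁ = contradiction (z∈exchange (z∈exchange w∈B₂ w≢y₀) w≢y₁) w∉D

  -- Exchange x for some y₀ ∈ B₂ and then y₀ back for some v ∈ B₁. If v ≠ x,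
  -- recurse with B₂ - y₀ + v, which is closer to B₁, and repair the result
  -- with detour-basis.
  symmetric-exchange : IsBasis B₁ → IsBasis B₂ → x ∈ B₁ → x ∉ B₂ → SymmetricExchange B₁ B₂ x
  symmetric-exchange = go (⊂-wellFounded _)
    where
    go : Acc _⊂_ (B₁ ─ B₂) → IsBasis B₁ → IsBasis B₂ → x ∈ B₁ → x ∉ B₂ → SymmetricExchange B₁ B₂ x
    go {B₁ = B₁} {B₂} {x} (acc closer) b₁ b₂ x∈B₁ x∉B₂
      with basis-exchange B₁ B₂ b₁ b₂ x x∈B₁ x∉B₂
    ... | y₀ , y₀∈B₂ , y₀∉B₁ , b₁′ with basis-exchange B₂ B₁ b₂ b₁ y₀ y₀∈B₂ y₀∉B₁
    ... | v , v∈B₁ , v∉B₂ , b₂′ with v ≟ x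
    ... | yes refl = y₀ , y₀∈B₂ , y₀∉B₁ , b₁′ , b₂′
    ... | no v≢x
      with go (closer (─-exchange-⊂ v∈B₁ v∉B₂ y₀∉B₁)) b₁ b₂′ x∈B₁ (z∉exchange x∉B₂ (v≢x ∘ sym))
    ... | y₁ , y₁∈B₂′ , y₁∉B₁ , b₁″ , bD with ∈-exchange⁻ B₂ y₀ v y₁∈B₂′
    ... | inj₂ refl = contradiction v∈B₁ y₁∉B₁
    ... | inj₁ (y₁∈B₂ , y₁≢y₀)
      with detour-basis b₂ y₀∈B₂ y₁∈B₂ (y₁≢y₀ ∘ sym) v∉B₂ (v≢x ∘ sym)
             (λ { refl → y₁∉B₁ v∈B₁ }) (λ { refl → x∉B₂ y₀∈B₂ }) bD
    ... | inj₁ b₂″ = y₁ , y₁∈B₂ , y₁∉B₁ , b₁″ , b₂″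
    ... | inj₂ b₂″ = y₀ , y₀∈B₂ , y₀∉B₁ , b₁′ , b₂″

  exchange-∩-≤1 : MeetsNoCircuitInOne M X → Nonempty X →
                  ∣ B₁ ∩ X ∣ ≤ 1 → ∣ B₂ ∩ X ∣ ≤ 1 → x ∈ B₁ → y ∈ B₂ →
                  IsBasis (exchange B₂ y x) → ∣ exchange B₁ x y ∩ X ∣ ≤ 1
  exchange-∩-≤1 {X = X} {B₁ = B₁} {B₂} {x} {y} meets-no-circuit-once nonempty ≤1₁ ≤1₂ x∈B₁ y∈B₂ b₂′
    with x ∈? X | y ∈? X
  ... | yes x∈X | _ = subst (∣ exchange B₁ x y ∩ X ∣ ≤_) (∣⁅x⁆∣≡1 y) (p⊆q⇒∣p∣≤∣q∣ only-y)
    where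
    only-y : exchange B₁ x y ∩ X ⊆ ⁅ y ⁆
    only-y z∈ with x∈p∩q⁻ _ X z∈
    ... | z∈B₁′ , z∈X with ∈-exchange⁻ B₁ x y z∈B₁′
    ...   | inj₂ refl        = x∈⁅x⁆ y
    ...   | inj₁ (z∈B₁ , z≢x) =
      contradiction (∣p∣≤1⇒x≡y ≤1₁ (x∈p∩q⁺ (z∈B₁ , z∈X)) (x∈p∩q⁺ (x∈B₁ , x∈X))) z≢x
  ... | no x∉X | no y∉X = ≤-trans (p⊆q⇒∣p∣≤∣q∣ inside-B₁) ≤1₁
    where
    inside-B₁ : exchange B₁ x y ∩ X ⊆ B₁ ∩ X
    inside-B₁ z∈ with x∈p∩q⁻ _ X z∈
    ... | z∈B₁′ , z∈X with ∈-exchange⁻ B₁ x y z∈B₁′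
    ...   | inj₂ refl       = contradiction z∈X y∉X
    ...   | inj₁ (z∈B₁ , _) = x∈p∩q⁺ (z∈B₁ , z∈X)
  ... | no x∉X | yes y∈X with basis-meets meets-no-circuit-once nonempty b₂′
  ...   | z , z∈ with x∈p∩q⁻ _ X z∈
  ...     | z∈B₂′ , z∈X with ∈-exchange⁻ B₂ y x z∈B₂′
  ...       | inj₂ refl        = contradiction z∈X x∉X
  ...       | inj₁ (z∈B₂ , z≢y) =
    contradiction (∣p∣≤1⇒x≡y ≤1₂ (x∈p∩q⁺ (z∈B₂ , z∈X)) (x∈p∩q⁺ (y∈B₂ , y∈X))) z≢y

lemma17 : (n : ℕ) (M : Matroid n) (𝒞 : Subset n → Set) →
          (∀ C → 𝒞 C → IsCut M C) →
          ∃[ B ] RestrictedBases M 𝒞 B →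
          IsMatroidBases n (RestrictedBases M 𝒞)
lemma17 n M 𝒞 cuts nonempty = record { basis-nonempty = nonempty ; basis-exchange = exchange′ }
  where
  exchange′ : ∀ B₁ B₂ → RestrictedBases M 𝒞 B₁ → RestrictedBases M 𝒞 B₂ → ∀ x → x ∈ B₁ → x ∉ B₂ →
              ∃[ y ] (y ∈ B₂ × y ∉ B₁ × RestrictedBases M 𝒞 (exchange B₁ x y))
  exchange′ B₁ B₂ (b₁ , ≤1₁) (b₂ , ≤1₂) x x∈B₁ x∉B₂ with symmetric-exchange M b₁ b₂ x∈B₁ x∉B₂
  ... | y , y∈B₂ , y∉B₁ , b₁′ , b₂′ = y , y∈B₂ , y∉B₁ , b₁′ , λ C C∈𝒞 →
    let (C-nonempty , C-meets-no-circuit-once , _) = cuts C C∈𝒞 in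
    exchange-∩-≤1 M C-meets-no-circuit-once C-nonempty (≤1₁ C C∈𝒞) (≤1₂ C C∈𝒞) x∈B₁ y∈B₂ b₂′
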